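{- Let $M\rightarrow M'$ be a matroid perspective on a finite linearly ordered set $E$. For $A\subseteq E$ let $f_{M,M'}(A)=(A\cup P_{M'}(A))\setminus Q_M(A)$. (a) For $A\subseteq E$ and $B=f_{M,M'}(A)$: $B$ is spanning in $M'$ and independent in $M$, $B\setminus\mathrm{Int}_{M'}(B)\subseteq A\subseteq B\cup\mathrm{Ext}_M(B)$, $\mathrm{Int}_{M'}(B)=\mathrm{Int}_{M'}(A)\cup P_{M'}(A)$, and $\mathrm{Ext}_M(B)=\mathrm{Ext}_M(A)\cup Q_M(A)$. (b) Conversely, let $B\subseteq E$ be spanning in $M'$ and independent in $M$, let $P\subseteq\mathrm{Int}_{M'}(B)$, $Q\subseteq\mathrm{Ext}_M(B)$, and $A=(B\setminus P)\cup Q$. Then $B=f_{M,M'}(A)$, $P_{M'}(A)=P$, $\mathrm{Int}_{M'}(A)=\mathrm{Int}_{M'}(B)\setminus P$, $Q_M(A)=Q$, and $\mathrm{Ext}_M(A)=\mathrm{Ext}_M(B)\setminus Q$. (c) Each set $B$ independent in $M$ and spanning in $M'$ is the unique such set in the interval $[B\setminus\mathrm{Int}_{M'}(B),B\cup\mathrm{Ext}_M(B)]$; the intervals associated with two distinct such sets are disjoint, and the collection of these intervals over all sets independent in $M$ and spanning in $M'$ is a partition of $2^E$. (d) The interval of this partition containing $A$ is $[g_{M,M'}(A),h_{M,M'}(A)]$ with $g_{M,M'}(A)=A\setminus\mathrm{Int}_{M'}(A)\setminus Q_M(A)$ and $h_{M,M'}(A)=A\cup\mathrm{Ext}_M(A)\cup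 P_{M'}(A)$.
   Context: A matroid perspective $M\rightarrow M'$ is a pair of matroids $M,M'$ on the same finite set $E$ such that every circuit of $M$ is a union of circuits of $M'$ (equivalently, no circuit of $M$ and cocircuit of $M'$ intersect in exactly one element). For a matroid $N$ on $E$ and $A\subseteq E$: $P_N(A)$ is the set of $e\in E\setminus A$ that are the smallest element of some cocircuit of $N$ contained in $E\setminus A$; $Q_N(A)$ is the set of $e\in A$ that are the smallest element of some circuit of $N$ contained in $A$; $\mathrm{Ext}_N(A)$ is the set of $e\in E\setminus A$ that are the smallest element of some circuit of $N$ contained in $A\cup\{e\}$; $\mathrm{Int}_N(A)$ is the set of $e\in A$ that are the smallest element of some cocircuit of $N$ contained in $(E\setminus A)\cup\{e\}$. For $X\subseteq Y\subseteq E$, $[X,Y]=\{Z: X\subseteq Z\subseteq Y\}$. -}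

module Defs where

open import Data.Nat using (ℕ; _<_)
open import Data.Fin using (Fin; _≤_)
open import Data.Fin.Subset using (Subset; _∈_; _∉_; _⊆_; _⊂_; _∪_; _∩_; ∁; ⁅_⁆; ⊥; ∣_∣; Empty)
open import Data.Product using (Σ; ∃; _×_)
open import Data.Sum using (_⊎_)
open import Function.Bundles using (_⇔_)
open import Relation.Nullary using (¬_; Dec)

-- Ground set E = Fin n, linearly ordered by the usual order on Fin n.  Derived sets (P, Q, Ext, Int, f, g, h)
-- are given as predicates on E; equality of sets is pointwise ⇔.

SetP : ℕ → Set₁
SetP n = Fin n → Set

⟦_⟧ : ∀ {n} → Subset n → SetP n
⟦ A ⟧ e = e ∈ A

infix 4 _≐_
_≐_ : ∀ {n} → SetP n → SetP n → Set
X ≐ Y = ∀ e → X e ⇔ Y e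

infixr 6 _∪ₚ_
_∪ₚ_ : ∀ {n} → SetP n → SetP n → SetP n
(X ∪ₚ Y) e = X e ⊎ Y e

infixl 5 _∖ₚ_
_∖ₚ_ : ∀ {n} → SetP n → SetP n → SetP n
(X ∖ₚ Y) e = X e × ¬ Y e

_∈[_,_] : ∀ {n} → Subset n → SetP n → SetP n → Set
Z ∈[ X , Y ] = (∀ e → X e → e ∈ Z) × (∀ e → e ∈ Z → Y e)

IsMin : ∀ {n} → Fin n → Subset n → Set
IsMin e X = e ∈ X × (∀ {x} → x ∈ X → e ≤ x)

-- Matroids on Fin n, via the independent-set axioms
-- (independence is required to be decidable, automatic for finite matroids
-- classically).

record Matroid (n : ℕ) : Set₁ where
  field
    Indep     : Subset n → Set
    Indep?    : ∀ X → Dec (Indep X)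
    indep-∅   : Indep ⊥
    indep-⊆   : ∀ {X Y} → X ⊆ Y → Indep Y → Indep X
    indep-aug : ∀ {X Y} → Indep X → Indep Y → ∣ X ∣ < ∣ Y ∣ →
                ∃ λ e → e ∈ Y × e ∉ X × Indep (X ∪ ⁅ e ⁆)

open Matroid public

module _ {n : ℕ} (M : Matroid n) where

  Circuit : Subset n → Set
  Circuit C = ¬ Indep M C × (∀ D → D ⊂ C → Indep M D)

  Basis : Subset n → Set
  Basis B = Indep M B × (∀ X → B ⊂ X → ¬ Indep M X)

  Spanning : Subset n → Set
  Spanning S = ∃ λ B → Basis B × B ⊆ S

  CoIndep : Subset n → Set
  CoIndep X = ∃ λ B → Basis B × Empty (X ∩ B)

  Cocircuit : Subset n → Set
  Cocircuit D = ¬ CoIndep D × (∀ D′ → D′ ⊂ D → CoIndep D′)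

  Pof : Subset n → SetP n
  Pof A e = e ∉ A × ∃ λ D → Cocircuit D × D ⊆ ∁ A × IsMin e D

  Qof : Subset n → SetP n
  Qof A e = e ∈ A × ∃ λ C → Circuit C × C ⊆ A × IsMin e C

  Ext : Subset n → SetP n
  Ext A e = e ∉ A × ∃ λ C → Circuit C × C ⊆ A ∪ ⁅ e ⁆ × IsMin e C

  Int : Subset n → SetP n
  Int A e = e ∈ A × ∃ λ D → Cocircuit D × D ⊆ ∁ A ∪ ⁅ e ⁆ × IsMin e D

-- matroid perspective M → M′: every circuit of M is a union of circuits of M′
Perspective : ∀ {n} → Matroid n → Matroid n → Set
Perspective M M′ =
  ∀ C → Circuit M C → ∀ e → e ∈ C → ∃ λ C′ → Circuit M′ C′ × e ∈ C′ × C′ ⊆ C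

module _ {n : ℕ} (M M′ : Matroid n) where

  f : Subset n → SetP n
  f A = (⟦ A ⟧ ∪ₚ Pof M′ A) ∖ₚ Qof M A

  g : Subset n → SetP n
  g A = ⟦ A ⟧ ∖ₚ Int M′ A ∖ₚ Qof M A

  h : Subset n → SetP n
  h A = ⟦ A ⟧ ∪ₚ Ext M A ∪ₚ Pof M′ A

  Good : Subset n → Set
  Good B = Indep M B × Spanning M′ B

  InIntervalOf : Subset n → Subset n → Set
  InIntervalOf B A = A ∈[ ⟦ B ⟧ ∖ₚ Int M′ B , ⟦ B ⟧ ∪ₚ Ext M B ]

module Submission where

-- Everything is expressed through two activity predicates of X ⊆ E:
--   e is M-active for X    iff  e ∈ cl_M {x ∈ X ∣ e < x}, so that
--                               Q_M(X) = X ∩ active, Ext_M(X) = (E ∖ X) ∩ active;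
--   e is M′-coactive for X iff  e ∉ cl_M′ ({x ∣ x < e} ∪ {x ∈ X ∣ e < x}), so that
--                               Int_M′(X) = X ∩ coactive, P_M′(X) = (E ∖ X) ∩ coactive.
-- Since cl_M ⊆ cl_M′ (the perspective), no element is active and coactive.
-- Key lemma (invariance): if Y agrees with X on the elements that are
-- neither active nor coactive for X, then X and Y have the same active and
-- coactive elements.  As B is M-independent iff no element of B is active,
-- and M′-spanning iff no element outside B is coactive, parts (a), (b), (d)
-- are bookkeeping with the invariance lemma, and (c) follows because f fixes
-- every such B.

open import Defs
open import Data.Nat as ℕ using (ℕ; zero; suc)
import Data.Nat.Properties as ℕP
open import Data.Fin as F using (Fin; _<_; _≤_)
import Data.Fin.Properties as FP
open import Data.Fin.Induction using (<-wellFounded; >-wellFounded)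
open import Data.Fin.Subset renaming (⊥ to ∅)
open import Data.Fin.Subset.Properties
open import Data.Vec using (tabulate; _∷_; here; there)
open import Data.Vec.Properties using (lookup∘tabulate; []=⇒lookup; lookup⇒[]=)
open import Data.Bool using (true; false)
open import Data.Product
open import Data.Sum
open import Data.Empty
open import Function using (case_of_)
open import Function.Bundles using (_⇔_; mk⇔; Equivalence)
open import Induction.WellFounded using (module All)
open import Relation.Binary using (tri<; tri≈; tri>)
open import Relation.Binary.PropositionalEquality
open import Relation.Nullary
open import Relation.Nullary.Decidable using (map′)
open import Relation.Unary using (Decidable)

open Equivalence using (to; from)

x∈p─q⇒x∉q : ∀ {n} {x : Fin n} (p q : Subset n) → x ∈ p ─ q → x ∉ q
x∈p─q⇒x∉q {x = F.zero}  (s ∷ p) (true ∷ q)  ()        here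
x∈p─q⇒x∉q {x = F.zero}  (s ∷ p) (false ∷ q) m         ()
x∈p─q⇒x∉q {x = F.suc x} (s ∷ p) (t ∷ q)     (there m) (there m′) = x∈p─q⇒x∉q p q m m′

∈─∪⇔ : ∀ {n} (B P Q : Subset n) e → e ∈ (B ─ P) ∪ Q ⇔ ((e ∈ B × e ∉ P) ⊎ e ∈ Q)
∈─∪⇔ B P Q e = mk⇔ split join
  where
  split : e ∈ (B ─ P) ∪ Q → (e ∈ B × e ∉ P) ⊎ e ∈ Q
  split m with x∈p∪q⁻ (B ─ P) Q m
  ... | inj₁ eB─P = inj₁ (p─q⊆p B P eB─P , x∈p─q⇒x∉q B P eB─P)
  ... | inj₂ eQ   = inj₂ eQ
  join : (e ∈ B × e ∉ P) ⊎ e ∈ Q → e ∈ (B ─ P) ∪ Q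
  join (inj₁ (eB , e∉P)) = x∈p∪q⁺ (inj₁ (x∈p∧x∉q⇒x∈p─q eB e∉P))
  join (inj₂ eQ)         = x∈p∪q⁺ (inj₂ eQ)

module _ {n : ℕ} where

  ∪⁅⁆⁻ : ∀ {S : Subset n} {e x} → x ∈ S ∪ ⁅ e ⁆ → x ∈ S ⊎ x ≡ e
  ∪⁅⁆⁻ {S} {e} m = Data.Sum.map₂ (x∈⁅y⁆⇒x≡y e) (x∈p∪q⁻ S ⁅ e ⁆ m)

  ∪⁅⁆ˡ : ∀ {S : Subset n} {e x} → x ∈ S → x ∈ S ∪ ⁅ e ⁆
  ∪⁅⁆ˡ m = x∈p∪q⁺ (inj₁ m)

  ∪⁅⁆ʳ : ∀ {S : Subset n} {e} → e ∈ S ∪ ⁅ e ⁆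
  ∪⁅⁆ʳ {S} {e} = x∈p∪q⁺ (inj₂ (x∈⁅x⁆ e))

  ⊂∪⁅⁆ : ∀ {S : Subset n} {e} → e ∉ S → S ⊂ S ∪ ⁅ e ⁆
  ⊂∪⁅⁆ {S} {e} e∉S = p⊆p∪q ⁅ e ⁆ , e , ∪⁅⁆ʳ , e∉S

  ∪⁅⁆-absorb : ∀ {S : Subset n} {e} → e ∈ S → S ∪ ⁅ e ⁆ ⊆ S
  ∪⁅⁆-absorb eS m = [ (λ xS → xS) , (λ { refl → eS }) ]′ (∪⁅⁆⁻ m)

  -⁻ : ∀ {S : Subset n} {e x} → x ∈ S - e → x ∈ S × x ≢ e
  -⁻ {S} {e} m = p─q⊆p S ⁅ e ⁆ m , λ { refl → x∈p─q⇒x∉q S ⁅ e ⁆ m (x∈⁅x⁆ e) }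

  ⟪_⟫ : {P : Fin n → Set} → Decidable P → Subset n
  ⟪ P? ⟫ = tabulate (λ x → does (P? x))

  ⟪⟫⁺ : ∀ {P : Fin n → Set} (P? : Decidable P) {x} → P x → x ∈ ⟪ P? ⟫
  ⟪⟫⁺ P? {x} px = lookup⇒[]= x _ (trans (lookup∘tabulate _ x) (does-true (P? x) px))
    where
    does-true : ∀ {A : Set} (d : Dec A) → A → does d ≡ true
    does-true (yes _) _ = refl
    does-true (no ¬a) a = ⊥-elim (¬a a)

  ⟪⟫⁻ : ∀ {P : Fin n → Set} (P? : Decidable P) {x} → x ∈ ⟪ P? ⟫ → P x
  ⟪⟫⁻ P? {x} m = true-does (P? x) (trans (sym (lookup∘tabulate _ x)) ([]=⇒lookup m))
    where
    true-does : ∀ {A : Set} (d : Dec A) → does d ≡ true → A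
    true-does (yes a) _ = a
    true-does (no _) ()

  greatest : ∀ {P : Fin n → Set} → Decidable P → ∀ x → P x →
             ∃ λ y → P y × (∀ {z} → y < z → ¬ P z)
  greatest {P} P? = All.wfRec >-wellFounded _ _ step
    where
    step : ∀ x → (∀ {y} → y F.> x → _) → P x → ∃ λ y → P y × (∀ {z} → y < z → ¬ P z)
    step x rec px with FP.any? (λ z → x FP.<? z ×-dec P? z)
    ... | yes (z , x<z , pz) = rec x<z pz
    ... | no ¬bigger = x , px , λ {z} x<z pz → ¬bigger (z , x<z , pz)

  least : ∀ {P : Fin n → Set} → Decidable P → ∀ x → P x →
          ∃ λ y → P y × (∀ {z} → z < y → ¬ P z)
  least {P} P? = All.wfRec <-wellFounded _ _ step
    where
    step : ∀ x → (∀ {y} → y < x → _) → P x → ∃ λ y → P y × (∀ {z} → z < y → ¬ P z)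
    step x rec px with FP.any? (λ z → z FP.<? x ×-dec P? z)
    ... | yes (z , z<x , pz) = rec z<x pz
    ... | no ¬smaller = x , px , λ {z} z<x pz → ¬smaller (z , z<x , pz)

module Closure {n : ℕ} (N : Matroid n) where

  dep-⊇ : ∀ {X Y} → X ⊆ Y → ¬ Indep N X → ¬ Indep N Y
  dep-⊇ X⊆Y dX iY = dX (indep-⊆ N X⊆Y iY)

  MaximalIn : Subset n → Subset n → Set
  MaximalIn S J = J ⊆ S × Indep N J × (∀ {x} → x ∈ S → x ∉ J → ¬ Indep N (J ∪ ⁅ x ⁆))

  -- Every independent subset of S extends to a maximal one; the size of the
  -- current set increases in each step, and at most n steps are possible.
  extendToMaximal : ∀ S I → I ⊆ S → Indep N I → ∃ λ J → I ⊆ J × MaximalIn S J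
  extendToMaximal S I₀ I₀⊆S iI₀ = go n I₀ (ℕP.m≤m+n n ∣ I₀ ∣) ⊆-refl I₀⊆S iI₀
    where
    go : ∀ fuel I → n ℕ.≤ fuel ℕ.+ ∣ I ∣ → I₀ ⊆ I → I ⊆ S → Indep N I →
         ∃ λ J → I₀ ⊆ J × MaximalIn S J
    go fuel I bound I₀⊆I I⊆S iI
      with FP.any? (λ x → x ∈? S ×-dec ¬? (x ∈? I) ×-dec Indep? N (I ∪ ⁅ x ⁆))
    ... | no ¬grow = I , I₀⊆I , I⊆S , iI , λ {x} xS x∉I ix → ¬grow (x , xS , x∉I , ix)
    ... | yes (x , xS , x∉I , ix) with fuel
    ...   | zero = ⊥-elim (ℕP.<-irrefl refl
                     (ℕP.<-≤-trans (ℕP.≤-<-trans bound (p⊂q⇒∣p∣<∣q∣ (⊂∪⁅⁆ x∉I)))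
                                   (∣p∣≤n (I ∪ ⁅ x ⁆))))
    ...   | suc fuel′ = go fuel′ (I ∪ ⁅ x ⁆) bound′ (λ m → ∪⁅⁆ˡ (I₀⊆I m)) Ix⊆S ix
      where
      bound′ : n ℕ.≤ fuel′ ℕ.+ ∣ I ∪ ⁅ x ⁆ ∣
      bound′ = ℕP.≤-trans bound (ℕP.≤-trans (ℕP.≤-reflexive (sym (ℕP.+-suc fuel′ ∣ I ∣)))
                                            (ℕP.+-monoʳ-≤ fuel′ (p⊂q⇒∣p∣<∣q∣ (⊂∪⁅⁆ x∉I))))
      Ix⊆S : I ∪ ⁅ x ⁆ ⊆ S
      Ix⊆S m = [ I⊆S , (λ { refl → xS }) ]′ (∪⁅⁆⁻ m)

  someMaximal : ∀ S → ∃ (MaximalIn S)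
  someMaximal S = let (J , _ , mJ) = extendToMaximal S ∅ ⊥⊆ (indep-∅ N) in J , mJ

  maximal-largest : ∀ {S J I} → MaximalIn S J → I ⊆ S → Indep N I → ∣ I ∣ ℕ.≤ ∣ J ∣
  maximal-largest (J⊆S , iJ , maxJ) I⊆S iI = ℕP.≮⇒≥ λ J<I →
    let (y , yI , y∉J , iJy) = indep-aug N iJ iI J<I in maxJ (I⊆S yI) y∉J iJy

  cl : Subset n → Fin n → Set
  cl S e = e ∈ S ⊎ ∃ λ I → I ⊆ S × Indep N I × ¬ Indep N (I ∪ ⁅ e ⁆)

  cl-mono : ∀ {S T e} → S ⊆ T → cl S e → cl T e
  cl-mono S⊆T (inj₁ eS) = inj₁ (S⊆T eS)
  cl-mono S⊆T (inj₂ (I , I⊆S , rest)) = inj₂ (I , (λ m → S⊆T (I⊆S m)) , rest)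

  -- Every element of cl S outside a maximal independent subset J of S is
  -- dependent on J: this is what makes cl S independent of the choice of I.
  cl-maximal : ∀ {S J e} → MaximalIn S J → cl S e → e ∉ J → ¬ Indep N (J ∪ ⁅ e ⁆)
  cl-maximal (J⊆S , iJ , maxJ) (inj₁ eS) e∉J = maxJ eS e∉J
  cl-maximal {S} {J} {e} mJ@(J⊆S , iJ , _) (inj₂ (I , I⊆S , iI , dIe)) e∉J iJe
    with extendToMaximal S I I⊆S iI
  ... | J′ , I⊆J′ , (J′⊆S , iJ′ , maxJ′)
    with indep-aug N iJ′ iJe
           (ℕP.≤-<-trans (maximal-largest mJ J′⊆S iJ′) (p⊂q⇒∣p∣<∣q∣ (⊂∪⁅⁆ e∉J)))
  ... | y , yJe , y∉J′ , iJ′y with ∪⁅⁆⁻ yJe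
  ...   | inj₁ yJ = maxJ′ (J⊆S yJ) y∉J′ iJ′y
  ...   | inj₂ refl = dIe (indep-⊆ N Ie⊆J′e iJ′y)
    where
    Ie⊆J′e : I ∪ ⁅ y ⁆ ⊆ J′ ∪ ⁅ y ⁆
    Ie⊆J′e m = [ (λ xI → ∪⁅⁆ˡ (I⊆J′ xI)) , (λ { refl → ∪⁅⁆ʳ }) ]′ (∪⁅⁆⁻ m)

  maximal-self : ∀ {Y} → Indep N Y → MaximalIn Y Y
  maximal-self iY = ⊆-refl , iY , λ yY y∉Y → ⊥-elim (y∉Y yY)

  cl-via-maximal : ∀ {S J e} → MaximalIn S J → cl S e → cl J e
  cl-via-maximal {J = J} {e = e} mJ c with e ∈? J
  ... | yes eJ = inj₁ eJ
  ... | no e∉J = inj₂ (J , ⊆-refl , proj₁ (proj₂ mJ) , cl-maximal mJ c e∉J)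

  cl-trans : ∀ {S T e} → (∀ {y} → y ∈ T → cl S y) → cl T e → cl S e
  cl-trans {S} {T} {e} T⊆clS c with someMaximal S
  ... | J , mJ@(J⊆S , iJ , maxJ) with e ∈? J
  ... | yes eJ = inj₁ (J⊆S eJ)
  ... | no e∉J = inj₂ (J , J⊆S , iJ , cl-maximal mJ′ (cl-mono (q⊆p∪q S T) c) e∉J)
    where
    -- J is still maximal in S ∪ T, since T adds nothing to the closure.
    mJ′ : MaximalIn (S ∪ T) J
    mJ′ = (λ m → p⊆p∪q T (J⊆S m)) , iJ , λ m x∉J → case x∈p∪q⁻ S T m of λ where
            (inj₁ xS) → maxJ xS x∉J
            (inj₂ xT) → cl-maximal mJ (T⊆clS xT) x∉J

  -- Closure is decidable: test e against a fixed maximal J ⊆ S.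
  cl? : ∀ S e → Dec (cl S e)
  cl? S e with someMaximal S
  ... | J , mJ with e ∈? S
  ... | yes eS = yes (inj₁ eS)
  ... | no e∉S with Indep? N (J ∪ ⁅ e ⁆)
  ... | no dJe = yes (inj₂ (J , proj₁ mJ , proj₁ (proj₂ mJ) , dJe))
  ... | yes iJe = no λ c → cl-maximal mJ c (λ eJ → e∉S (proj₁ mJ eJ)) iJe

  circuit⇒cl : ∀ {C S e} → Circuit N C → e ∈ C → C ⊆ S ∪ ⁅ e ⁆ → cl S e
  circuit⇒cl {C} {S} {e} (dC , minC) eC C⊆ with e ∈? S
  ... | yes eS = inj₁ eS
  ... | no e∉S = inj₂ (C - e , C-e⊆S , minC (C - e) (x∈p⇒p-x⊂p eC) , dep-⊇ C⊆C-e+e dC)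
    where
    C-e⊆S : C - e ⊆ S
    C-e⊆S m with -⁻ m
    ... | xC , x≢e = [ (λ xS → xS) , (λ x≡e → ⊥-elim (x≢e x≡e)) ]′ (∪⁅⁆⁻ (C⊆ xC))
    C⊆C-e+e : C ⊆ (C - e) ∪ ⁅ e ⁆
    C⊆C-e+e {x} xC with x FP.≟ e
    ... | yes refl = ∪⁅⁆ʳ
    ... | no x≢e = ∪⁅⁆ˡ (x∈p∧x≢y⇒x∈p-y xC x≢e)

  dependent⇒circuit : ∀ S → ¬ Indep N S → ∃ λ C → C ⊆ S × Circuit N C
  dependent⇒circuit S₀ dS₀ = go (suc ∣ S₀ ∣) S₀ ℕP.≤-refl dS₀
    where
    go : ∀ fuel S → ∣ S ∣ ℕ.< fuel → ¬ Indep N S → ∃ λ C → C ⊆ S × Circuit N C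
    go zero S () dS
    go (suc fuel) S lt dS with FP.any? (λ x → x ∈? S ×-dec ¬? (Indep? N (S - x)))
    ... | yes (x , xS , dS-x) =
      let (C , C⊆ , cC) = go fuel (S - x) (ℕP.<-≤-trans (x∈p⇒∣p-x∣<∣p∣ xS) (ℕP.≤-pred lt)) dS-x
      in C , (λ m → proj₁ (-⁻ (C⊆ m))) , cC
    ... | no ¬shrink = S , ⊆-refl , dS , minimal
      where
      minimal : ∀ D → D ⊂ S → Indep N D
      minimal D (D⊆S , x , xS , x∉D) with Indep? N (S - x)
      ... | yes iS-x = indep-⊆ N (λ m → x∈p∧x≢y⇒x∈p-y (D⊆S m) λ { refl → x∉D m }) iS-x
      ... | no dS-x = ⊥-elim (¬shrink (x , xS , dS-x))

  cl⇒circuit : ∀ {S e} → cl S e → e ∉ S → ∃ λ C → Circuit N C × e ∈ C × C ⊆ S ∪ ⁅ e ⁆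
  cl⇒circuit (inj₁ eS) e∉S = ⊥-elim (e∉S eS)
  cl⇒circuit {S} {e} (inj₂ (I , I⊆S , iI , dIe)) e∉S with dependent⇒circuit (I ∪ ⁅ e ⁆) dIe
  ... | C , C⊆ , cC with e ∈? C
  ... | yes eC = C , cC , eC , λ m → [ (λ xI → ∪⁅⁆ˡ (I⊆S xI)) , (λ { refl → ∪⁅⁆ʳ }) ]′ (∪⁅⁆⁻ (C⊆ m))
  ... | no e∉C = ⊥-elim (proj₁ cC (indep-⊆ N C⊆I iI))
    where
    C⊆I : C ⊆ I
    C⊆I m = [ (λ xI → xI) , (λ { refl → ⊥-elim (e∉C m) }) ]′ (∪⁅⁆⁻ (C⊆ m))

  circuit-nonempty : ∀ {C} → Circuit N C → ∃ λ x → x ∈ C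
  circuit-nonempty {C} (dC , _) with nonempty? C
  ... | yes ne = ne
  ... | no empty = ⊥-elim (dC (subst (Indep N) (sym (Empty-unique empty)) (indep-∅ N)))

  maximal⇒basis : ∀ {J} → MaximalIn ⊤ J → Basis N J
  maximal⇒basis (_ , iJ , maxJ) = iJ , λ where
    X (J⊆X , x , xX , x∉J) iX →
      maxJ ∈⊤ x∉J (indep-⊆ N (λ m → [ J⊆X , (λ { refl → xX }) ]′ (∪⁅⁆⁻ m)) iX)

  basis⇒maximal : ∀ {B} → Basis N B → MaximalIn ⊤ B
  basis⇒maximal (iB , maxB) = (λ _ → ∈⊤) , iB , λ _ x∉B iBx → maxB _ (⊂∪⁅⁆ x∉B) iBx

  basis-spans : ∀ {B} → Basis N B → ∀ x → cl B x
  basis-spans bB x = cl-via-maximal (basis⇒maximal bB) (inj₁ ∈⊤)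

  basis-exists : ∃ (Basis N)
  basis-exists = let (J , mJ) = someMaximal ⊤ in J , maximal⇒basis mJ

  spanning-indep⇒basis : ∀ {Y} → Indep N Y → (∀ x → cl Y x) → Basis N Y
  spanning-indep⇒basis iY spans =
    maximal⇒basis ((λ _ → ∈⊤) , iY , λ {x} _ x∉Y → cl-maximal (maximal-self iY) (spans x) x∉Y)

  spans-basis⇒contains-basis : ∀ {B S} → Basis N B → (∀ {b} → b ∈ B → cl S b) →
                               ∃ λ B₀ → Basis N B₀ × B₀ ⊆ S
  spans-basis⇒contains-basis {B} {S} bB B⊆clS with someMaximal S
  ... | J , mJ@(J⊆S , iJ , _) =
    J , maximal⇒basis ((λ _ → ∈⊤) , iJ , λ {x} _ x∉J →
          cl-maximal mJ (cl-trans B⊆clS (basis-spans bB x)) x∉J) , J⊆S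

module Cocircuits {n : ℕ} (N : Matroid n) where
  open Closure N

  orthogonal : ∀ {C D p} → Circuit N C → Cocircuit N D → p ∈ C → p ∈ D →
               (∀ {x} → x ∈ C → x ∈ D → x ≡ p) → ⊥
  orthogonal {C} {D} {p} cC (dD , minD) pC pD C∩D⊆p
    with minD (D - p) (x∈p⇒p-x⊂p pD)
  ... | B , bB , D-p∩B=∅ with spans-basis⇒contains-basis {S = ∁ D} bB B⊆cl∁D
    where
    -- p is spanned by the rest of C, which lies outside D.
    B⊆cl∁D : ∀ {b} → b ∈ B → cl (∁ D) b
    B⊆cl∁D {b} bB′ with b ∈? D
    ... | no b∉D = inj₁ (x∉p⇒x∈∁p b∉D)
    ... | yes bD with b FP.≟ p
    ... | no b≢p = ⊥-elim (D-p∩B=∅ (b , x∈p∩q⁺ (x∈p∧x≢y⇒x∈p-y bD b≢p , bB′)))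
    ... | yes refl = circuit⇒cl cC pC λ {x} xC → case x ∈? D of λ where
          (yes xD) → subst (λ z → z ∈ ∁ D ∪ ⁅ b ⁆) (sym (C∩D⊆p xC xD)) ∪⁅⁆ʳ
          (no x∉D) → ∪⁅⁆ˡ (x∉p⇒x∈∁p x∉D)
  ... | B₀ , bB₀ , B₀⊆∁D =
    dD (B₀ , bB₀ , λ (x , m) → let (xD , xB₀) = x∈p∩q⁻ D B₀ m in x∈∁p⇒x∉p (B₀⊆∁D xB₀) xD)

  -- The fundamental cocircuit of a basis B at p ∈ B: the complement of
  -- cl (B - p).
  module Fundamental {B p} (bB : Basis N B) (pB : p ∈ B) where

    outside? : Decidable (λ x → ¬ cl (B - p) x)
    outside? x = ¬? (cl? (B - p) x)

    D : Subset n
    D = ⟪ outside? ⟫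

    D⁻ : ∀ {x} → x ∈ D → ¬ cl (B - p) x
    D⁻ = ⟪⟫⁻ outside?

    iB-p : Indep N (B - p)
    iB-p = indep-⊆ N (p─q⊆p B ⁅ p ⁆) (proj₁ bB)

    p∉B-p : p ∉ B - p
    p∉B-p m = proj₂ (-⁻ m) refl

    p∈D : p ∈ D
    p∈D = ⟪⟫⁺ outside? λ c → cl-maximal (maximal-self iB-p) c p∉B-p
            (indep-⊆ N (λ m → [ (λ a → proj₁ (-⁻ a)) , (λ { refl → pB }) ]′ (∪⁅⁆⁻ m)) (proj₁ bB))

    -- The complement of D is the closure of B - p, which contains no basis.
    D-dependent : ¬ CoIndep N D
    D-dependent (B₁ , bB₁ , D∩B₁=∅) with spans-basis⇒contains-basis {S = B - p} bB₁ B₁⊆cl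
      where
      B₁⊆cl : ∀ {b} → b ∈ B₁ → cl (B - p) b
      B₁⊆cl {b} bB₁′ with cl? (B - p) b
      ... | yes c = c
      ... | no ¬c = ⊥-elim (D∩B₁=∅ (b , x∈p∩q⁺ (⟪⟫⁺ outside? ¬c , bB₁′)))
    ... | B₀ , bB₀ , B₀⊆B-p =
      proj₂ bB₀ B ((λ m → proj₁ (-⁻ (B₀⊆B-p m))) , p , pB , λ m → p∉B-p (B₀⊆B-p m)) (proj₁ bB)

    exchange : ∀ {x} → x ∈ D → Basis N ((B - p) ∪ ⁅ x ⁆)
    exchange {x} xD = spanning-indep⇒basis indep (λ y → cl-trans B⊆cl (basis-spans bB y))
      where
      indep : Indep N ((B - p) ∪ ⁅ x ⁆)
      indep with Indep? N ((B - p) ∪ ⁅ x ⁆)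
      ... | yes i = i
      ... | no d = ⊥-elim (D⁻ xD (inj₂ (B - p , ⊆-refl , iB-p , d)))
      -- p lies in the fundamental circuit of x with respect to B.
      p∈cl : cl ((B - p) ∪ ⁅ x ⁆) p
      p∈cl with x FP.≟ p
      ... | yes refl = inj₁ ∪⁅⁆ʳ
      ... | no x≢p with x ∈? B
      ... | yes xB = ⊥-elim (D⁻ xD (inj₁ (x∈p∧x≢y⇒x∈p-y xB x≢p)))
      ... | no x∉B with cl⇒circuit (basis-spans bB x) x∉B
      ... | C , cC , xC , C⊆B+x with p ∈? C
      ... | no p∉C = ⊥-elim (D⁻ xD (circuit⇒cl cC xC λ {y} m → case ∪⁅⁆⁻ (C⊆B+x m) of λ where
              (inj₁ yB) → ∪⁅⁆ˡ (x∈p∧x≢y⇒x∈p-y yB (λ { refl → p∉C m }))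
              (inj₂ refl) → ∪⁅⁆ʳ))
      ... | yes pC = circuit⇒cl cC pC λ {y} m → case ∪⁅⁆⁻ (C⊆B+x m) of λ where
              (inj₁ yB) → case y FP.≟ p of λ where
                 (yes refl) → ∪⁅⁆ʳ
                 (no y≢p) → ∪⁅⁆ˡ (∪⁅⁆ˡ (x∈p∧x≢y⇒x∈p-y yB y≢p))
              (inj₂ refl) → ∪⁅⁆ˡ ∪⁅⁆ʳ
      B⊆cl : ∀ {b} → b ∈ B → cl ((B - p) ∪ ⁅ x ⁆) b
      B⊆cl {b} bB′ with b FP.≟ p
      ... | yes refl = p∈cl
      ... | no b≢p = inj₁ (∪⁅⁆ˡ (x∈p∧x≢y⇒x∈p-y bB′ b≢p))

    -- Every proper subset of D misses one of the bases (B - p) ∪ {x}.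
    D-minimal : ∀ D′ → D′ ⊂ D → CoIndep N D′
    D-minimal D′ (D′⊆D , x , xD , x∉D′) = (B - p) ∪ ⁅ x ⁆ , exchange xD , disjoint
      where
      disjoint : Empty (D′ ∩ ((B - p) ∪ ⁅ x ⁆))
      disjoint (y , m) with x∈p∩q⁻ D′ _ m
      ... | yD′ , yB′ with ∪⁅⁆⁻ yB′
      ... | inj₁ yB-p = D⁻ (D′⊆D yD′) (inj₁ yB-p)
      ... | inj₂ refl = x∉D′ yD′

    cocircuit : Cocircuit N D
    cocircuit = D-dependent , D-minimal

  -- The elements that a cocircuit D ⊆ (E ∖ X) ∪ {p} with least element p
  -- must avoid: everything below p, and the elements of X above p.
  Avoid : Subset n → Fin n → Subset n
  Avoid X p = ⟪ (λ x → x FP.<? p ⊎-dec (x ∈? X ×-dec p FP.<? x)) ⟫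

  Avoid⁻ : ∀ {X p x} → x ∈ Avoid X p → x < p ⊎ (x ∈ X × p < x)
  Avoid⁻ {X} {p} = ⟪⟫⁻ (λ x → x FP.<? p ⊎-dec (x ∈? X ×-dec p FP.<? x))

  Avoid⁺ : ∀ {X p x} → x < p ⊎ (x ∈ X × p < x) → x ∈ Avoid X p
  Avoid⁺ {X} {p} = ⟪⟫⁺ (λ x → x FP.<? p ⊎-dec (x ∈? X ×-dec p FP.<? x))

  p∉Avoid : ∀ {X p} → p ∉ Avoid X p
  p∉Avoid m = [ FP.<-irrefl refl , (λ (_ , p<p) → FP.<-irrefl refl p<p) ]′ (Avoid⁻ m)

  -- If such a cocircuit exists, Avoid X p does not span p (by orthogonality).
  cocircuit⇒unspanned : ∀ {X p D} → Cocircuit N D → D ⊆ ∁ X ∪ ⁅ p ⁆ → IsMin p D →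
                        ¬ cl (Avoid X p) p
  cocircuit⇒unspanned {X} {p} {D} cD D⊆ (pD , minD) c with cl⇒circuit c p∉Avoid
  ... | C , cC , pC , C⊆ = orthogonal cC cD pC pD C∩D⊆p
    where
    C∩D⊆p : ∀ {x} → x ∈ C → x ∈ D → x ≡ p
    C∩D⊆p xC xD with ∪⁅⁆⁻ (C⊆ xC)
    ... | inj₂ x≡p = x≡p
    ... | inj₁ xAvoid with Avoid⁻ xAvoid
    ... | inj₁ x<p = ⊥-elim (ℕP.<⇒≱ x<p (minD xD))
    ... | inj₂ (xX , _) = [ (λ x∉X → ⊥-elim (x∈∁p⇒x∉p x∉X xX)) , (λ x≡p → x≡p) ]′ (∪⁅⁆⁻ (D⊆ xD))

  -- Conversely, if Avoid X p does not span p, the fundamental cocircuit at p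
  -- of a basis extending (a maximal independent subset of Avoid X p) ∪ {p}
  -- is such a cocircuit.
  unspanned⇒cocircuit : ∀ {X p} → ¬ cl (Avoid X p) p →
                        ∃ λ D → Cocircuit N D × D ⊆ ∁ X ∪ ⁅ p ⁆ × IsMin p D
  unspanned⇒cocircuit {X} {p} ¬c with someMaximal (Avoid X p)
  ... | I , mI@(I⊆Avoid , iI , _) with Indep? N (I ∪ ⁅ p ⁆)
  ... | no dIp = ⊥-elim (¬c (inj₂ (I , I⊆Avoid , iI , dIp)))
  ... | yes iIp with extendToMaximal ⊤ (I ∪ ⁅ p ⁆) (λ _ → ∈⊤) iIp
  ... | B , Ip⊆B , mB = D , cocircuit , D⊆ , p∈D , D≥p
    where
    open Fundamental (maximal⇒basis mB) (Ip⊆B ∪⁅⁆ʳ)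
    Avoid⊆cl : ∀ {x} → x ∈ Avoid X p → cl (B - p) x
    Avoid⊆cl xAvoid = cl-mono I⊆B-p (cl-via-maximal mI (inj₁ xAvoid))
      where
      I⊆B-p : I ⊆ B - p
      I⊆B-p m = x∈p∧x≢y⇒x∈p-y (Ip⊆B (∪⁅⁆ˡ m)) λ { refl → p∉Avoid (I⊆Avoid m) }
    D≥p : ∀ {x} → x ∈ D → p ≤ x
    D≥p xD = ℕP.≮⇒≥ λ x<p → D⁻ xD (Avoid⊆cl (Avoid⁺ (inj₁ x<p)))
    D⊆ : D ⊆ ∁ X ∪ ⁅ p ⁆
    D⊆ {x} xD with x FP.≟ p
    ... | yes refl = ∪⁅⁆ʳ
    ... | no x≢p with x ∈? X
    ... | no x∉X = ∪⁅⁆ˡ (x∉p⇒x∈∁p x∉X)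
    ... | yes xX = ⊥-elim (D⁻ xD (Avoid⊆cl (Avoid⁺ (inj₂ (xX , p<x)))))
      where p<x = FP.≤∧≢⇒< (D≥p xD) (λ p≡x → x≢p (sym p≡x))

-- Suppose q ∈ cl_N (L ∪ V), where every v ∈ V lies above q, is not spanned
-- in N′ by Avoid X v, and every element of L above v is in X.  Then already
-- q ∈ cl_N L: otherwise the largest element v of V on a circuit through q
-- would be spanned by that circuit inside Avoid X v.
module Elimination {n : ℕ} (N N′ : Matroid n)
                   (cl⊆cl′ : ∀ {S e} → Closure.cl N S e → Closure.cl N′ S e) where
  open Closure N
  open Cocircuits N′ using (Avoid; Avoid⁺)

  drop-unspanned : (X L V : Subset n) (q : Fin n) → q ∉ L → q ∉ V →
                   (∀ {v} → v ∈ V → ¬ Closure.cl N′ (Avoid X v) v) →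
                   (∀ {v} → v ∈ V → q < v) →
                   (∀ {v x} → v ∈ V → x ∈ L → v < x → x ∈ X) →
                   cl (L ∪ V) q → cl L q
  drop-unspanned X L V q q∉L q∉V unspanned V>q L>V⊆X c
    with cl⇒circuit c (λ m → [ q∉L , q∉V ]′ (x∈p∪q⁻ L V m))
  ... | C , cC , qC , C⊆ with FP.any? (λ x → x ∈? C ×-dec x ∈? V)
  ... | no C∩V=∅ = circuit⇒cl cC qC λ {y} m → case ∪⁅⁆⁻ (C⊆ m) of λ where
          (inj₂ refl) → ∪⁅⁆ʳ
          (inj₁ yL∪V) → case x∈p∪q⁻ L V yL∪V of λ where
             (inj₁ yL) → ∪⁅⁆ˡ yL
             (inj₂ yV) → ⊥-elim (C∩V=∅ (y , m , yV))
  ... | yes (x₀ , x₀C , x₀V) with greatest (λ x → x ∈? C ×-dec x ∈? V) x₀ (x₀C , x₀V)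
  ... | v , (vC , vV) , v-greatest = ⊥-elim (unspanned vV (cl⊆cl′ (circuit⇒cl cC vC C⊆Avoid)))
    where
    C⊆Avoid : C ⊆ Avoid X v ∪ ⁅ v ⁆
    C⊆Avoid {y} m with FP.<-cmp y v
    ... | tri< y<v _ _ = ∪⁅⁆ˡ (Avoid⁺ (inj₁ y<v))
    ... | tri≈ _ refl _ = ∪⁅⁆ʳ
    ... | tri> _ _ v<y with ∪⁅⁆⁻ (C⊆ m)
    ... | inj₂ refl = ⊥-elim (FP.<-asym (V>q vV) v<y)
    ... | inj₁ yL∪V with x∈p∪q⁻ L V yL∪V
    ... | inj₁ yL = ∪⁅⁆ˡ (Avoid⁺ (inj₂ (L>V⊆X vV yL v<y , v<y)))
    ... | inj₂ yV = ⊥-elim (v-greatest v<y (m , yV))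

module Activities {n : ℕ} (M M′ : Matroid n) (persp : Perspective M M′) where
  module CM = Closure M
  module CM′ = Closure M′
  open Cocircuits M′ using (Avoid; Avoid⁺; Avoid⁻; p∉Avoid;
                            cocircuit⇒unspanned; unspanned⇒cocircuit)

  -- Closure in M is contained in closure in M′: a circuit of M through e is
  -- a union of circuits of M′, one of which passes through e.
  perspective-cl : ∀ {S e} → CM.cl S e → CM′.cl S e
  perspective-cl (inj₁ eS) = inj₁ eS
  perspective-cl {S} {e} c@(inj₂ _) with e ∈? S
  ... | yes eS = inj₁ eS
  ... | no e∉S with CM.cl⇒circuit c e∉S
  ... | C , cC , eC , C⊆ with persp C cC e eC
  ... | C′ , cC′ , eC′ , C′⊆C = CM′.circuit⇒cl cC′ eC′ (λ m → C⊆ (C′⊆C m))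

  above? : (X : Subset n) (d : Fin n) → Decidable (λ x → x ∈ X × d < x)
  above? X d x = x ∈? X ×-dec d FP.<? x

  Above : Subset n → Fin n → Subset n
  Above X d = ⟪ above? X d ⟫

  Above⁻ : ∀ {X d x} → x ∈ Above X d → x ∈ X × d < x
  Above⁻ {X} {d} = ⟪⟫⁻ (above? X d)

  Above⁺ : ∀ {X d x} → x ∈ X → d < x → x ∈ Above X d
  Above⁺ {X} {d} xX d<x = ⟪⟫⁺ (above? X d) (xX , d<x)

  d∉Above : ∀ {X d} → d ∉ Above X d
  d∉Above m = FP.<-irrefl refl (proj₂ (Above⁻ m))

  Above-mono : ∀ {X Y t u} → (∀ {x} → x ∈ X → x ∈ Y) → t ≤ u → Above X u ⊆ Above Y t
  Above-mono X⊆Y t≤u m = let (xX , u<x) = Above⁻ m in Above⁺ (X⊆Y xX) (ℕP.≤-<-trans t≤u u<x)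

  Active : Subset n → Fin n → Set
  Active X d = CM.cl (Above X d) d

  Coactive : Subset n → Fin n → Set
  Coactive X p = ¬ CM′.cl (Avoid X p) p

  active? : ∀ X d → Dec (Active X d)
  active? X d = CM.cl? (Above X d) d

  coactive? : ∀ X p → Dec (Coactive X p)
  coactive? X p = ¬? (CM′.cl? (Avoid X p) p)

  -- No element is both active and coactive; this is where M → M′ is used.
  active-coactive-disjoint : ∀ {X e} → Active X e → Coactive X e → ⊥
  active-coactive-disjoint a ¬c =
    ¬c (CM′.cl-mono (λ m → let (xX , e<x) = Above⁻ m in Avoid⁺ (inj₂ (xX , e<x))) (perspective-cl a))

  circuit⇒active : ∀ {X e C} → Circuit M C → C ⊆ X ∪ ⁅ e ⁆ → IsMin e C → Active X e
  circuit⇒active {X} {e} {C} cC C⊆ (eC , e-min) = CM.circuit⇒cl cC eC C⊆Above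
    where
    C⊆Above : C ⊆ Above X e ∪ ⁅ e ⁆
    C⊆Above {x} m with x FP.≟ e
    ... | yes refl = ∪⁅⁆ʳ
    ... | no x≢e = [ (λ xX → ∪⁅⁆ˡ (Above⁺ xX (FP.≤∧≢⇒< (e-min m) (λ e≡x → x≢e (sym e≡x)))))
                   , (λ x≡e → ⊥-elim (x≢e x≡e)) ]′ (∪⁅⁆⁻ (C⊆ m))

  active⇒circuit : ∀ {X e} → Active X e → ∃ λ C → Circuit M C × C ⊆ X ∪ ⁅ e ⁆ × IsMin e C
  active⇒circuit {X} {e} a with CM.cl⇒circuit a d∉Above
  ... | C , cC , eC , C⊆ = C , cC , C⊆X+e , eC , e-min
    where
    C⊆X+e : C ⊆ X ∪ ⁅ e ⁆
    C⊆X+e m = [ (λ xA → ∪⁅⁆ˡ (proj₁ (Above⁻ xA))) , (λ { refl → ∪⁅⁆ʳ }) ]′ (∪⁅⁆⁻ (C⊆ m))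
    e-min : ∀ {x} → x ∈ C → e ≤ x
    e-min m = [ (λ xA → ℕP.<⇒≤ (proj₂ (Above⁻ xA))) , (λ { refl → ℕP.≤-refl }) ]′ (∪⁅⁆⁻ (C⊆ m))

  Q⇔ : ∀ {X e} → Qof M X e ⇔ (e ∈ X × Active X e)
  Q⇔ {X} = mk⇔ (λ (eX , C , cC , C⊆ , e-min) → eX , circuit⇒active cC (λ m → ∪⁅⁆ˡ (C⊆ m)) e-min)
               (λ (eX , a) → let (C , cC , C⊆ , e-min) = active⇒circuit a
                             in eX , C , cC , (λ m → ∪⁅⁆-absorb eX (C⊆ m)) , e-min)

  Ext⇔ : ∀ {X e} → Ext M X e ⇔ (e ∉ X × Active X e)
  Ext⇔ = mk⇔ (λ (e∉X , C , cC , C⊆ , e-min) → e∉X , circuit⇒active cC C⊆ e-min)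
             (λ (e∉X , a) → e∉X , active⇒circuit a)

  P⇔ : ∀ {X e} → Pof M′ X e ⇔ (e ∉ X × Coactive X e)
  P⇔ {X} {e} = mk⇔ (λ (e∉X , D , cD , D⊆ , e-min) → e∉X , cocircuit⇒unspanned cD (λ m → ∪⁅⁆ˡ (D⊆ m)) e-min)
                   (λ (e∉X , c) → let (D , cD , D⊆ , e-min) = unspanned⇒cocircuit c
                                  in e∉X , D , cD , (λ m → ∪⁅⁆-absorb (x∉p⇒x∈∁p e∉X) (D⊆ m)) , e-min)

  Int⇔ : ∀ {X e} → Int M′ X e ⇔ (e ∈ X × Coactive X e)
  Int⇔ = mk⇔ (λ (eX , D , cD , D⊆ , e-min) → eX , cocircuit⇒unspanned cD D⊆ e-min)
             (λ (eX , c) → eX , unspanned⇒cocircuit c)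

module Invariance {n : ℕ} (M M′ : Matroid n) (persp : Perspective M M′) where
  open Activities M M′ persp
  open Cocircuits M′ using (Avoid; Avoid⁺; Avoid⁻)

  module SamePassive (X Y : Subset n)
    (agree : ∀ x → ¬ Active X x → ¬ Coactive X x → (x ∈ X → x ∈ Y) × (x ∈ Y → x ∈ X)) where

    core? : Decidable (λ x → x ∈ X × ¬ Active X x × ¬ Coactive X x)
    core? x = x ∈? X ×-dec ¬? (active? X x) ×-dec ¬? (coactive? X x)

    Core : Subset n
    Core = ⟪ core? ⟫

    Core⁺ : ∀ {x} → x ∈ X → ¬ Active X x → ¬ Coactive X x → x ∈ Core
    Core⁺ xX ¬a ¬c = ⟪⟫⁺ core? (xX , ¬a , ¬c)

    Core⊆X : ∀ {x} → x ∈ Core → x ∈ X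
    Core⊆X m = proj₁ (⟪⟫⁻ core? m)

    Core⊆Y : ∀ {x} → x ∈ Core → x ∈ Y
    Core⊆Y {x} m = let (xX , ¬a , ¬c) = ⟪⟫⁻ core? m in proj₁ (agree x ¬a ¬c) xX

    -- An active element u is spanned by the non-coactive elements of X
    -- above it: a coactive y on the circuit witnessing u would be spanned in
    -- M, hence in M′, by Avoid X y.
    noncoactive? : (u : Fin n) → Decidable (λ x → x ∈ X × u < x × ¬ Coactive X x)
    noncoactive? u x = x ∈? X ×-dec u FP.<? x ×-dec ¬? (coactive? X x)

    active⇒spanned-by-noncoactive : ∀ {u} → Active X u → CM.cl ⟪ noncoactive? u ⟫ u
    active⇒spanned-by-noncoactive {u} a with CM.cl⇒circuit a d∉Above
    ... | C , cC , uC , C⊆ = CM.circuit⇒cl cC uC C⊆noncoactive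
      where
      C⊆noncoactive : C ⊆ ⟪ noncoactive? u ⟫ ∪ ⁅ u ⁆
      C⊆noncoactive {y} m with ∪⁅⁆⁻ (C⊆ m)
      ... | inj₂ refl = ∪⁅⁆ʳ
      ... | inj₁ yAbove with Above⁻ yAbove
      ... | yX , u<y with coactive? X y
      ... | no ¬c = ∪⁅⁆ˡ (⟪⟫⁺ (noncoactive? u) (yX , u<y , ¬c))
      ... | yes c = ⊥-elim (c (perspective-cl (CM.circuit⇒cl cC m C⊆Avoid)))
        where
        C⊆Avoid : C ⊆ Avoid X y ∪ ⁅ y ⁆
        C⊆Avoid {z} mz with FP.<-cmp z y
        ... | tri< z<y _ _ = ∪⁅⁆ˡ (Avoid⁺ (inj₁ z<y))
        ... | tri≈ _ refl _ = ∪⁅⁆ʳ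
        ... | tri> _ _ y<z with ∪⁅⁆⁻ (C⊆ mz)
        ... | inj₂ refl = ⊥-elim (FP.<-asym u<y y<z)
        ... | inj₁ zAbove = ∪⁅⁆ˡ (Avoid⁺ (inj₂ (proj₁ (Above⁻ zAbove) , y<z)))

    active⇒spanned-by-core : ∀ u → Active X u → CM.cl (Above Core u) u
    active⇒spanned-by-core = All.wfRec >-wellFounded _ _ step
      where
      step : ∀ u → (∀ {y} → u < y → Active X y → CM.cl (Above Core y) y) →
             Active X u → CM.cl (Above Core u) u
      step u ih a = CM.cl-trans noncoactive⊆cl (active⇒spanned-by-noncoactive a)
        where
        noncoactive⊆cl : ∀ {y} → y ∈ ⟪ noncoactive? u ⟫ → CM.cl (Above Core u) y
        noncoactive⊆cl {y} m with ⟪⟫⁻ (noncoactive? u) m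
        ... | yX , u<y , ¬c with active? X y
        ... | yes ay = CM.cl-mono (Above-mono (λ z → z) (ℕP.<⇒≤ u<y)) (ih u<y ay)
        ... | no ¬ay = inj₁ (Above⁺ (Core⁺ yX ¬ay ¬c) u<y)

    active-X⇒Y : ∀ {d} → Active X d → Active Y d
    active-X⇒Y {d} a = CM.cl-mono (Above-mono Core⊆Y ℕP.≤-refl) (active⇒spanned-by-core d a)

    -- Conversely, the elements of Y above d are spanned by Core together with
    -- coactive elements of X, and the latter can be dropped by elimination.
    coactiveY? : (d : Fin n) → Decidable (λ x → x ∈ Y × d < x × Coactive X x)
    coactiveY? d x = x ∈? Y ×-dec d FP.<? x ×-dec coactive? X x

    active-Y⇒X : ∀ {d} → Active Y d → Active X d
    active-Y⇒X {d} a = CM.cl-mono (Above-mono Core⊆X ℕP.≤-refl)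
      (Elimination.drop-unspanned M M′ perspective-cl X (Above Core d) V d d∉Above
        (λ m → FP.<-irrefl refl (proj₁ (proj₂ (⟪⟫⁻ (coactiveY? d) m))))
        (λ m → proj₂ (proj₂ (⟪⟫⁻ (coactiveY? d) m)))
        (λ m → proj₁ (proj₂ (⟪⟫⁻ (coactiveY? d) m)))
        (λ _ m _ → Core⊆X (proj₁ (Above⁻ m)))
        (CM.cl-trans AboveY⊆cl a))
      where
      V = ⟪ coactiveY? d ⟫
      AboveY⊆cl : ∀ {y} → y ∈ Above Y d → CM.cl (Above Core d ∪ V) y
      AboveY⊆cl {y} m with Above⁻ m
      ... | yY , d<y with active? X y
      ... | yes ay = CM.cl-mono (λ z → p⊆p∪q V (Above-mono (λ w → w) (ℕP.<⇒≤ d<y) z))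
                                (active⇒spanned-by-core y ay)
      ... | no ¬ay with coactive? X y
      ... | yes cy = inj₁ (q⊆p∪q (Above Core d) V (⟪⟫⁺ (coactiveY? d) (yY , d<y , cy)))
      ... | no ¬cy = inj₁ (p⊆p∪q V (Above⁺ (Core⁺ (proj₂ (agree y ¬ay ¬cy) yY) ¬ay ¬cy) d<y))

    -- For W = X or W = Y, Avoid W p spans p in M′ iff Avoid Core p does.
    module ViaCore (W : Subset n)
      (passiveW⊆X : ∀ y → y ∈ W → ¬ Active X y → ¬ Coactive X y → y ∈ X)
      (Core⊆W : Core ⊆ W) where

      fromCore : ∀ {p} → CM′.cl (Avoid Core p) p → CM′.cl (Avoid W p) p
      fromCore {p} = CM′.cl-mono λ m → case Avoid⁻ m of λ where
        (inj₁ x<p) → Avoid⁺ (inj₁ x<p)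
        (inj₂ (xCore , p<x)) → Avoid⁺ (inj₂ (Core⊆W xCore , p<x))

      coactiveW? : (p : Fin n) → Decidable (λ x → x ∈ W × p < x × Coactive X x)
      coactiveW? p x = x ∈? W ×-dec p FP.<? x ×-dec coactive? X x

      toCore : ∀ {p} → CM′.cl (Avoid W p) p → CM′.cl (Avoid Core p) p
      toCore {p} c = Elimination.drop-unspanned M′ M′ (λ z → z) X (Avoid Core p) V p
        p∉Avoid
        (λ m → FP.<-irrefl refl (proj₁ (proj₂ (⟪⟫⁻ (coactiveW? p) m))))
        (λ m → proj₂ (proj₂ (⟪⟫⁻ (coactiveW? p) m)))
        (λ m → proj₁ (proj₂ (⟪⟫⁻ (coactiveW? p) m)))
        (λ {v} {x} vV xAvoid v<x → case Avoid⁻ xAvoid of λ where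
          (inj₁ x<p) → ⊥-elim (FP.<-asym (FP.<-trans (proj₁ (proj₂ (⟪⟫⁻ (coactiveW? p) vV))) v<x) x<p)
          (inj₂ (xCore , _)) → Core⊆X xCore)
        (CM′.cl-trans AvoidW⊆cl c)
        where
        open Cocircuits M′ using (p∉Avoid)
        V = ⟪ coactiveW? p ⟫
        AvoidW⊆cl : ∀ {y} → y ∈ Avoid W p → CM′.cl (Avoid Core p ∪ V) y
        AvoidW⊆cl {y} m with Avoid⁻ m
        ... | inj₁ y<p = inj₁ (p⊆p∪q V (Avoid⁺ (inj₁ y<p)))
        ... | inj₂ (yW , p<y) with active? X y
        ... | yes ay = CM′.cl-mono
                         (λ z → p⊆p∪q V (Avoid⁺ (inj₂ (proj₁ (Above⁻ z) , FP.<-trans p<y (proj₂ (Above⁻ z))))))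
                         (perspective-cl (active⇒spanned-by-core y ay))
        ... | no ¬ay with coactive? X y
        ... | yes cy = inj₁ (q⊆p∪q (Avoid Core p) V (⟪⟫⁺ (coactiveW? p) (yW , p<y , cy)))
        ... | no ¬cy = inj₁ (p⊆p∪q V (Avoid⁺ (inj₂ (Core⁺ (passiveW⊆X y yW ¬ay ¬cy) ¬ay ¬cy , p<y))))

    module ViaCoreX = ViaCore X (λ y yX _ _ → yX) Core⊆X
    module ViaCoreY = ViaCore Y (λ y yY ¬a ¬c → proj₂ (agree y ¬a ¬c) yY) Core⊆Y

    coactive-X⇒Y : ∀ {p} → Coactive X p → Coactive Y p
    coactive-X⇒Y c spanned = c (ViaCoreX.fromCore (ViaCoreY.toCore spanned))

    coactive-Y⇒X : ∀ {p} → Coactive Y p → Coactive X p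
    coactive-Y⇒X c spanned = c (ViaCoreY.fromCore (ViaCoreX.toCore spanned))

module Parts {n : ℕ} (M M′ : Matroid n) (persp : Perspective M M′) where
  open Activities M M′ persp
  open Invariance M M′ persp using (module SamePassive)
  open Cocircuits M′ using (Avoid; Avoid⁻)

  -- Independence in M and spanning in M′ via activities: B is independent
  -- iff no element of B is active for B (look at the least element of a
  -- circuit in B), and spanning iff no element outside B is coactive.
  indep⇒¬active : ∀ {B e} → Indep M B → e ∈ B → ¬ Active B e
  indep⇒¬active iB eB a with from Q⇔ (eB , a)
  ... | _ , C , cC , C⊆B , _ = proj₁ cC (indep-⊆ M C⊆B iB)

  spanning⇒¬coactive : ∀ {B e} → Spanning M′ B → e ∉ B → ¬ Coactive B e
  spanning⇒¬coactive (B₀ , bB₀ , B₀⊆B) e∉B c with from P⇔ (e∉B , c)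
  ... | _ , D , cD , D⊆∁B , _ = proj₁ cD (B₀ , bB₀ , λ (y , m) →
          let (yD , yB₀) = x∈p∩q⁻ D B₀ m in x∈∁p⇒x∉p (D⊆∁B yD) (B₀⊆B yB₀))

  ¬active⇒indep : ∀ {B} → (∀ {e} → e ∈ B → ¬ Active B e) → Indep M B
  ¬active⇒indep {B} ¬active with Indep? M B
  ... | yes iB = iB
  ... | no dB with CM.dependent⇒circuit B dB
  ... | C , C⊆B , cC with CM.circuit-nonempty cC
  ... | x , xC with least (_∈? C) x xC
  ... | m , mC , m-least = ⊥-elim (¬active (C⊆B mC)
    (circuit⇒active cC (λ y → ∪⁅⁆ˡ (C⊆B y)) (mC , λ yC → ℕP.≮⇒≥ λ y<m → m-least y<m yC)))

  -- Otherwise every element is spanned by B, by induction upwards: a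
  -- non-coactive e ∉ B is spanned by Avoid B e, i.e. by smaller elements and
  -- elements of B.
  ¬coactive⇒spanning : ∀ {B} → (∀ {e} → e ∉ B → ¬ Coactive B e) → Spanning M′ B
  ¬coactive⇒spanning {B} ¬coactive =
    let (B′ , bB′) = CM′.basis-exists in CM′.spans-basis⇒contains-basis bB′ (λ {b} _ → spanned b)
    where
    spanned : ∀ y → CM′.cl B y
    spanned = All.wfRec <-wellFounded _ _ step
      where
      step : ∀ y → (∀ {z} → z < y → CM′.cl B z) → CM′.cl B y
      step y ih with y ∈? B
      ... | yes yB = inj₁ yB
      ... | no y∉B with CM′.cl? (Avoid B y) y
      ... | no ¬c = ⊥-elim (¬coactive y∉B ¬c)
      ... | yes c = CM′.cl-trans (λ {z} m → [ ih , (λ (zB , _) → inj₁ zB) ]′ (Avoid⁻ m)) c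

  f⇔ : ∀ {A e} → f M M′ A e ⇔ ((e ∈ A × ¬ Active A e) ⊎ (e ∉ A × Coactive A e))
  f⇔ {A} {e} = mk⇔ to′ from′
    where
    to′ : f M M′ A e → (e ∈ A × ¬ Active A e) ⊎ (e ∉ A × Coactive A e)
    to′ (inj₁ eA , ¬q) = inj₁ (eA , λ a → ¬q (from Q⇔ (eA , a)))
    to′ (inj₂ p , _) = inj₂ (to P⇔ p)
    from′ : (e ∈ A × ¬ Active A e) ⊎ (e ∉ A × Coactive A e) → f M M′ A e
    from′ (inj₁ (eA , ¬a)) = inj₁ eA , λ q → ¬a (proj₂ (to Q⇔ q))
    from′ (inj₂ (e∉A , c)) = inj₂ (from P⇔ (e∉A , c)) , λ q → e∉A (proj₁ (to Q⇔ q))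

  f? : (A : Subset n) → Decidable (f M M′ A)
  f? A e = map′ (from f⇔) (to f⇔) ((e ∈? A ×-dec ¬? (active? A e)) ⊎-dec (¬? (e ∈? A) ×-dec coactive? A e))

  -- Part (a): B = f(A) agrees with A on the passive elements of A.
  module PartA (A B : Subset n) (B≐fA : ⟦ B ⟧ ≐ f M M′ A) where

    B⇔ : ∀ {e} → e ∈ B ⇔ ((e ∈ A × ¬ Active A e) ⊎ (e ∉ A × Coactive A e))
    B⇔ {e} = mk⇔ (λ eB → to f⇔ (to (B≐fA e) eB)) (λ r → from (B≐fA e) (from f⇔ r))

    agree : ∀ x → ¬ Active A x → ¬ Coactive A x → (x ∈ A → x ∈ B) × (x ∈ B → x ∈ A)
    agree x ¬a ¬c = (λ xA → from B⇔ (inj₁ (xA , ¬a))) ,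
                    λ xB → [ proj₁ , (λ (_ , c) → ⊥-elim (¬c c)) ]′ (to B⇔ xB)

    open SamePassive A B agree

    good : Good M M′ B
    good = ¬active⇒indep (λ {e} eB aB → case to B⇔ eB of λ where
              (inj₁ (_ , ¬a)) → ¬a (active-Y⇒X aB)
              (inj₂ (_ , c)) → active-coactive-disjoint (active-Y⇒X aB) c)
         , ¬coactive⇒spanning (λ {e} e∉B cB → case e ∈? A of λ where
              (yes eA) → e∉B (from B⇔ (inj₁ (eA , λ a → active-coactive-disjoint a (coactive-Y⇒X cB))))
              (no e∉A) → e∉B (from B⇔ (inj₂ (e∉A , coactive-Y⇒X cB))))

    lower : ∀ e → (⟦ B ⟧ ∖ₚ Int M′ B) e → e ∈ A
    lower e (eB , ¬int) with to B⇔ eB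
    ... | inj₁ (eA , _) = eA
    ... | inj₂ (_ , c) = ⊥-elim (¬int (from Int⇔ (eB , coactive-X⇒Y c)))

    upper : ∀ e → e ∈ A → (⟦ B ⟧ ∪ₚ Ext M B) e
    upper e eA with e ∈? B
    ... | yes eB = inj₁ eB
    ... | no e∉B with active? A e
    ... | yes a = inj₂ (from Ext⇔ (e∉B , active-X⇒Y a))
    ... | no ¬a = ⊥-elim (e∉B (from B⇔ (inj₁ (eA , ¬a))))

    Int≐ : Int M′ B ≐ Int M′ A ∪ₚ Pof M′ A
    Int≐ e = mk⇔ to′ from′
      where
      to′ : Int M′ B e → (Int M′ A ∪ₚ Pof M′ A) e
      to′ i with to Int⇔ i
      ... | _ , cB with e ∈? A
      ... | yes eA = inj₁ (from Int⇔ (eA , coactive-Y⇒X cB))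
      ... | no e∉A = inj₂ (from P⇔ (e∉A , coactive-Y⇒X cB))
      from′ : (Int M′ A ∪ₚ Pof M′ A) e → Int M′ B e
      from′ (inj₁ i) = let (eA , cA) = to Int⇔ i in
        from Int⇔ (from B⇔ (inj₁ (eA , λ a → active-coactive-disjoint a cA)) , coactive-X⇒Y cA)
      from′ (inj₂ p) = let (e∉A , cA) = to P⇔ p in
        from Int⇔ (from B⇔ (inj₂ (e∉A , cA)) , coactive-X⇒Y cA)

    Ext≐ : Ext M B ≐ Ext M A ∪ₚ Qof M A
    Ext≐ e = mk⇔ to′ from′
      where
      to′ : Ext M B e → (Ext M A ∪ₚ Qof M A) e
      to′ x with to Ext⇔ x
      ... | _ , aB with e ∈? A
      ... | yes eA = inj₂ (from Q⇔ (eA , active-Y⇒X aB))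
      ... | no e∉A = inj₁ (from Ext⇔ (e∉A , active-Y⇒X aB))
      active⇒∉B : Active A e → e ∉ B
      active⇒∉B aA eB = [ (λ (_ , ¬a) → ¬a aA) , (λ (_ , c) → active-coactive-disjoint aA c) ]′ (to B⇔ eB)
      from′ : (Ext M A ∪ₚ Qof M A) e → Ext M B e
      from′ (inj₁ x) = let (_ , aA) = to Ext⇔ x in from Ext⇔ (active⇒∉B aA , active-X⇒Y aA)
      from′ (inj₂ q) = let (_ , aA) = to Q⇔ q in from Ext⇔ (active⇒∉B aA , active-X⇒Y aA)

  -- Part (b), for P ⊆ Int_M′(B) and Q ⊆ Ext_M(B) given as predicates and A
  -- described by A = (B ∖ P) ∪ Q: A agrees with B on the passive elements
  -- of B, and the activities of B decide everything.
  module PartB (B : Subset n) (goodB : Good M M′ B) (P Q : Fin n → Set) (P? : Decidable P)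
               (P⊆Int : ∀ {e} → P e → Int M′ B e) (Q⊆Ext : ∀ {e} → Q e → Ext M B e)
               (A : Subset n) (A⇔ : ∀ e → e ∈ A ⇔ ((e ∈ B × ¬ P e) ⊎ Q e)) where

    B-¬active : ∀ {e} → e ∈ B → ¬ Active B e
    B-¬active = indep⇒¬active (proj₁ goodB)

    ∁B-¬coactive : ∀ {e} → e ∉ B → ¬ Coactive B e
    ∁B-¬coactive = spanning⇒¬coactive (proj₂ goodB)

    P-coactive : ∀ {e} → P e → e ∈ B × Coactive B e
    P-coactive pe = to Int⇔ (P⊆Int pe)

    Q-active : ∀ {e} → Q e → e ∉ B × Active B e
    Q-active qe = to Ext⇔ (Q⊆Ext qe)

    agree : ∀ x → ¬ Active B x → ¬ Coactive B x → (x ∈ B → x ∈ A) × (x ∈ A → x ∈ B)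
    agree x ¬a ¬c = (λ xB → from (A⇔ x) (inj₁ (xB , λ pe → ¬c (proj₂ (P-coactive pe))))) ,
                    λ xA → [ proj₁ , (λ qe → ⊥-elim (¬a (proj₂ (Q-active qe)))) ]′ (to (A⇔ x) xA)

    open SamePassive B A agree

    P∉A : ∀ {e} → P e → e ∉ A
    P∉A pe eA = [ (λ (_ , ¬pe) → ¬pe pe) , (λ qe → proj₁ (Q-active qe) (proj₁ (P-coactive pe))) ]′
                  (to (A⇔ _) eA)

    B≐f : ⟦ B ⟧ ≐ f M M′ A
    B≐f e = mk⇔ to′ from′
      where
      to′ : e ∈ B → f M M′ A e
      to′ eB with P? e
      ... | yes pe = from f⇔ (inj₂ (P∉A pe , coactive-X⇒Y (proj₂ (P-coactive pe))))
      ... | no ¬pe = from f⇔ (inj₁ (from (A⇔ e) (inj₁ (eB , ¬pe)) , λ a → B-¬active eB (active-Y⇒X a)))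
      from′ : f M M′ A e → e ∈ B
      from′ fe with to f⇔ fe
      ... | inj₁ (eA , ¬a) = [ proj₁ , (λ qe → ⊥-elim (¬a (active-X⇒Y (proj₂ (Q-active qe))))) ]′
                               (to (A⇔ e) eA)
      ... | inj₂ (_ , cA) with e ∈? B
      ... | yes eB = eB
      ... | no e∉B = ⊥-elim (∁B-¬coactive e∉B (coactive-Y⇒X cA))

    Pof≐P : Pof M′ A ≐ P
    Pof≐P e = mk⇔ to′ (λ pe → from P⇔ (P∉A pe , coactive-X⇒Y (proj₂ (P-coactive pe))))
      where
      to′ : Pof M′ A e → P e
      to′ p with to P⇔ p | P? e
      ... | _ | yes pe = pe
      ... | e∉A , cA | no ¬pe with e ∈? B
      ... | yes eB = ⊥-elim (e∉A (from (A⇔ e) (inj₁ (eB , ¬pe))))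
      ... | no e∉B = ⊥-elim (∁B-¬coactive e∉B (coactive-Y⇒X cA))

    Int≐ : Int M′ A ≐ Int M′ B ∖ₚ P
    Int≐ e = mk⇔ to′ from′
      where
      to′ : Int M′ A e → (Int M′ B ∖ₚ P) e
      to′ i with to Int⇔ i
      ... | eA , cA with to (A⇔ e) eA
      ... | inj₁ (eB , ¬pe) = from Int⇔ (eB , coactive-Y⇒X cA) , ¬pe
      ... | inj₂ qe = ⊥-elim (active-coactive-disjoint (proj₂ (Q-active qe)) (coactive-Y⇒X cA))
      from′ : (Int M′ B ∖ₚ P) e → Int M′ A e
      from′ (i , ¬pe) = let (eB , cB) = to Int⇔ i in
        from Int⇔ (from (A⇔ e) (inj₁ (eB , ¬pe)) , coactive-X⇒Y cB)

    Qof≐Q : Qof M A ≐ Q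
    Qof≐Q e = mk⇔ to′ (λ qe → from Q⇔ (from (A⇔ e) (inj₂ qe) , active-X⇒Y (proj₂ (Q-active qe))))
      where
      to′ : Qof M A e → Q e
      to′ q with to Q⇔ q
      ... | eA , aA = [ (λ (eB , _) → ⊥-elim (B-¬active eB (active-Y⇒X aA))) , (λ qe → qe) ]′
                        (to (A⇔ e) eA)

    Ext≐ : Ext M A ≐ Ext M B ∖ₚ Q
    Ext≐ e = mk⇔ to′ from′
      where
      to′ : Ext M A e → (Ext M B ∖ₚ Q) e
      to′ x with to Ext⇔ x
      ... | e∉A , aA = from Ext⇔ ((λ eB → B-¬active eB (active-Y⇒X aA)) , active-Y⇒X aA)
                     , λ qe → e∉A (from (A⇔ e) (inj₂ qe))
      from′ : (Ext M B ∖ₚ Q) e → Ext M A e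
      from′ (x , ¬qe) = let (e∉B , aB) = to Ext⇔ x in
        from Ext⇔ ((λ eA → [ (λ (eB , _) → e∉B eB) , ¬qe ]′ (to (A⇔ e) eA)) , active-X⇒Y aB)

  -- A set A in the interval of a good set B is of the form of part (b), with
  -- P = B ∖ A and Q = A ∖ B; this yields part (d).
  module Interval (A B : Subset n) (goodB : Good M M′ B) (inB : InIntervalOf M M′ B A) where

    P⊆Int : ∀ {e} → e ∈ B × e ∉ A → Int M′ B e
    P⊆Int {e} (eB , e∉A) with coactive? B e
    ... | yes c = from Int⇔ (eB , c)
    ... | no ¬c = ⊥-elim (e∉A (proj₁ inB e (eB , λ i → ¬c (proj₂ (to Int⇔ i)))))

    Q⊆Ext : ∀ {e} → e ∈ A × e ∉ B → Ext M B e
    Q⊆Ext {e} (eA , e∉B) = [ (λ eB → ⊥-elim (e∉B eB)) , (λ x → x) ]′ (proj₂ inB e eA)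

    A⇔ : ∀ e → e ∈ A ⇔ ((e ∈ B × ¬ (e ∈ B × e ∉ A)) ⊎ (e ∈ A × e ∉ B))
    A⇔ e = mk⇔ to′ from′
      where
      to′ : e ∈ A → (e ∈ B × ¬ (e ∈ B × e ∉ A)) ⊎ (e ∈ A × e ∉ B)
      to′ eA with e ∈? B
      ... | yes eB = inj₁ (eB , λ (_ , e∉A) → e∉A eA)
      ... | no e∉B = inj₂ (eA , e∉B)
      from′ : (e ∈ B × ¬ (e ∈ B × e ∉ A)) ⊎ (e ∈ A × e ∉ B) → e ∈ A
      from′ (inj₁ (eB , ¬p)) with e ∈? A
      ... | yes eA = eA
      ... | no e∉A = ⊥-elim (¬p (eB , e∉A))
      from′ (inj₂ (eA , _)) = eA

    open PartB B goodB (λ e → e ∈ B × e ∉ A) (λ e → e ∈ A × e ∉ B)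
               (λ e → e ∈? B ×-dec ¬? (e ∈? A)) P⊆Int Q⊆Ext A A⇔ public

    g≐ : ⟦ B ⟧ ∖ₚ Int M′ B ≐ g M M′ A
    g≐ e = mk⇔ to′ from′
      where
      to′ : (⟦ B ⟧ ∖ₚ Int M′ B) e → g M M′ A e
      to′ (eB , ¬int) = (proj₁ inB e (eB , ¬int) , λ i → ¬int (proj₁ (to (Int≐ e) i)))
                      , λ q → proj₂ (to (Qof≐Q e) q) eB
      from′ : g M M′ A e → (⟦ B ⟧ ∖ₚ Int M′ B) e
      from′ ((eA , ¬intA) , ¬q) with e ∈? B
      ... | yes eB = eB , λ i → ¬intA (from (Int≐ e) (i , λ (_ , e∉A) → e∉A eA))
      ... | no e∉B = ⊥-elim (¬q (from (Qof≐Q e) (eA , e∉B)))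

    h≐ : ⟦ B ⟧ ∪ₚ Ext M B ≐ h M M′ A
    h≐ e = mk⇔ to′ from′
      where
      to′ : (⟦ B ⟧ ∪ₚ Ext M B) e → h M M′ A e
      to′ x with e ∈? A
      ... | yes eA = inj₁ eA
      to′ (inj₁ eB) | no e∉A = inj₂ (inj₂ (from (Pof≐P e) (eB , e∉A)))
      to′ (inj₂ x)  | no e∉A = inj₂ (inj₁ (from (Ext≐ e) (x , λ (eA , _) → e∉A eA)))
      from′ : h M M′ A e → (⟦ B ⟧ ∪ₚ Ext M B) e
      from′ (inj₁ eA) = proj₂ inB e eA
      from′ (inj₂ (inj₁ x)) = inj₂ (proj₁ (to (Ext≐ e) x))
      from′ (inj₂ (inj₂ p)) = inj₁ (proj₁ (to (Pof≐P e) p))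

  -- f fixes every good set (part (b) with P = Q = ∅) ...
  f-fixes-good : ∀ B → Good M M′ B → ⟦ B ⟧ ≐ f M M′ B
  f-fixes-good B goodB = PartB.B≐f B goodB (λ _ → ⊥) (λ _ → ⊥) (λ _ → no (λ ())) (λ ()) (λ ())
    B (λ e → mk⇔ (λ eB → inj₁ (eB , λ ())) [ proj₁ , (λ ()) ]′)

  -- ... so a good set is determined by any set in its interval, namely as f
  -- of that set.
  good-is-f : ∀ A B → Good M M′ B → InIntervalOf M M′ B A → ⟦ B ⟧ ≐ f M M′ A
  good-is-f A B goodB inB = Interval.B≐f A B goodB inB

  ≐⇒≡ : ∀ {B B′ : Subset n} {F : SetP n} → ⟦ B ⟧ ≐ F → ⟦ B′ ⟧ ≐ F → B ≡ B′
  ≐⇒≡ B≐F B′≐F = ⊆-antisym (λ {x} m → from (B′≐F x) (to (B≐F x) m))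
                           (λ {x} m → from (B≐F x) (to (B′≐F x) m))

  unique-in-interval : ∀ (B B′ : Subset n) → Good M M′ B → Good M M′ B′ →
                       InIntervalOf M M′ B B′ → B′ ≡ B
  unique-in-interval B B′ goodB goodB′ inB =
    ≐⇒≡ (f-fixes-good B′ goodB′) (good-is-f B′ B goodB inB)

  intervals-disjoint : ∀ (B B′ A : Subset n) → Good M M′ B → Good M M′ B′ → B ≢ B′ →
                       ¬ (InIntervalOf M M′ B A × InIntervalOf M M′ B′ A)
  intervals-disjoint B B′ A goodB goodB′ B≢B′ (inB , inB′) =
    B≢B′ (≐⇒≡ (good-is-f A B goodB inB) (good-is-f A B′ goodB′ inB′))

  intervals-cover : ∀ (A : Subset n) → ∃ λ B → Good M M′ B × InIntervalOf M M′ B A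
  intervals-cover A = ⟪ f? A ⟫ , good , lower , upper
    where open PartA A ⟪ f? A ⟫ (λ e → mk⇔ (⟪⟫⁻ (f? A)) (⟪⟫⁺ (f? A)))

proposition2 : ∀ {n} (M M′ : Matroid n) → Perspective M M′ →
    -- (a)
    (∀ (A B : Subset n) → ⟦ B ⟧ ≐ f M M′ A →
        Good M M′ B
      × (∀ e → (⟦ B ⟧ ∖ₚ Int M′ B) e → e ∈ A)
      × (∀ e → e ∈ A → (⟦ B ⟧ ∪ₚ Ext M B) e)
      × (Int M′ B ≐ Int M′ A ∪ₚ Pof M′ A)
      × (Ext M B ≐ Ext M A ∪ₚ Qof M A))
    -- (b)
    × (∀ (B P Q : Subset n) → Good M M′ B →
        (∀ e → e ∈ P → Int M′ B e) → (∀ e → e ∈ Q → Ext M B e) →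
          (⟦ B ⟧ ≐ f M M′ ((B ─ P) ∪ Q))
        × (Pof M′ ((B ─ P) ∪ Q) ≐ ⟦ P ⟧)
        × (Int M′ ((B ─ P) ∪ Q) ≐ Int M′ B ∖ₚ ⟦ P ⟧)
        × (Qof M ((B ─ P) ∪ Q) ≐ ⟦ Q ⟧)
        × (Ext M ((B ─ P) ∪ Q) ≐ Ext M B ∖ₚ ⟦ Q ⟧))
    -- (c)
    × (∀ (B B′ : Subset n) → Good M M′ B → Good M M′ B′ →
         InIntervalOf M M′ B B′ → B′ ≡ B)
    × (∀ (B B′ A : Subset n) → Good M M′ B → Good M M′ B′ → B ≢ B′ →
         ¬ (InIntervalOf M M′ B A × InIntervalOf M M′ B′ A))
    × (∀ (A : Subset n) → ∃ λ B → Good M M′ B × InIntervalOf M M′ B A)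
    -- (d)
    × (∀ (A B : Subset n) → Good M M′ B → InIntervalOf M M′ B A →
          (⟦ B ⟧ ∖ₚ Int M′ B ≐ g M M′ A)
        × (⟦ B ⟧ ∪ₚ Ext M B ≐ h M M′ A))
proposition2 M M′ persp =
    (λ A B B≐fA → let open PartA A B B≐fA in good , lower , upper , Int≐ , Ext≐)
  , (λ B P Q goodB P⊆Int Q⊆Ext →
       let open PartB B goodB (_∈ P) (_∈ Q) (_∈? P) (P⊆Int _) (Q⊆Ext _) ((B ─ P) ∪ Q) (∈─∪⇔ B P Q)
       in B≐f , Pof≐P , Int≐ , Qof≐Q , Ext≐)
  , unique-in-interval
  , intervals-disjoint
  , intervals-cover
  , (λ A B goodB inB → let open Interval A B goodB inB in g≐ , h≐)
  where open Parts M M′ persp
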